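{- Let $M=(E,\mathcal L)$ be a uniform oriented matroid of rank $d$, let $D=\{e_1,\dots,e_d\}\subseteq E$ be a $d$-element subset, and let $X_1,\dots,X_d\in\mathcal L$ be cocircuits such that $X_i(e_j)=0$ for all $i\ne j$ and $X_1|_{E\setminus D}=X_2|_{E\setminus D}=\dots=X_d|_{E\setminus D}$. If $X\in\mathcal L$ is a cocircuit such that for every $1\le i\le d$ either $X(e_i)=X_i(e_i)$ or $X(e_i)=0$, then $X\in\{X_1,\dots,X_d\}$.
   Context: An oriented matroid is given by its set of covectors $\mathcal L\subseteq\{+,-,0\}^E$; cocircuits are the minimal nonzero covectors with respect to the componentwise order in which $0<+$ and $0<-$. A rank-$d$ oriented matroid is uniform if every $d$-element subset of $E$ is independent. -}

module Defs where

open import Data.Nat using (ℕ; suc)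
open import Data.Fin using (Fin)
open import Data.Vec using (Vec; lookup)
open import Data.Product using (Σ; ∃; _×_; _,_)
open import Data.Sum using (_⊎_)
open import Relation.Nullary using (¬_)
open import Relation.Binary.PropositionalEquality using (_≡_; _≢_)
open import Level using (Level; _⊔_) renaming (suc to lsuc)
open import Function.Definitions using (Injective)

data Sign : Set where
  pos neg nil : Sign

opp : Sign → Sign
opp pos = neg
opp neg = pos
opp nil = nil

-- Ground set E = Fin n; sign vectors as Vec Sign n
SignVec : ℕ → Set
SignVec n = Vec Sign n

zeroVec : ∀ {n} → SignVec n
zeroVec {n} = Data.Vec.replicate n nil

negVec : ∀ {n} → SignVec n → SignVec n
negVec = Data.Vec.map opp

composeS : Sign → Sign → Sign
composeS nil t = t
composeS s   t = s

compose : ∀ {n} → SignVec n → SignVec n → SignVec n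
compose = Data.Vec.zipWith composeS

Separates : ∀ {n} → SignVec n → SignVec n → Fin n → Set
Separates X Y e = (lookup X e ≢ nil) × (lookup X e ≡ opp (lookup Y e))

_≼_ : ∀ {n} → SignVec n → SignVec n → Set
Y ≼ X = ∀ e → (lookup Y e ≡ nil) ⊎ (lookup Y e ≡ lookup X e)

-- Covector axioms of an oriented matroid on E = Fin n
record IsOrientedMatroid {ℓ} (n : ℕ) (L : SignVec n → Set ℓ) : Set ℓ where
  field
    L0 : L zeroVec
    L1 : ∀ X → L X → L (negVec X)
    L2 : ∀ X Y → L X → L Y → L (compose X Y)
    L3 : ∀ X Y → L X → L Y → ∀ e → Separates X Y e →
         Σ (SignVec n) λ Z → L Z × (lookup Z e ≡ nil) ×
           (∀ f → ¬ Separates X Y f → lookup Z f ≡ lookup (compose X Y) f)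

IsCocircuit : ∀ {ℓ n} → (SignVec n → Set ℓ) → SignVec n → Set ℓ
IsCocircuit L X = L X × (X ≢ zeroVec) ×
  (∀ Y → L Y → Y ≼ X → (Y ≡ zeroVec) ⊎ (Y ≡ X))

-- Independence of the set {s 0, …, s (k-1)} (s injective) in the underlying
-- matroid: every element e of the set lies outside the closure of the rest,
-- i.e. there is a covector nonzero at e and vanishing on the rest of the set.
Independent : ∀ {ℓ n k} → (SignVec n → Set ℓ) → (Fin k → Fin n) → Set ℓ
Independent L s = ∀ i → Σ _ λ X → L X × (lookup X (s i) ≢ nil) ×
  (∀ j → j ≢ i → lookup X (s j) ≡ nil)

HasRank : ∀ {ℓ n} → (SignVec n → Set ℓ) → ℕ → Set ℓ
HasRank {n = n} L d =
  (Σ (Fin d → Fin n) λ s → Injective _≡_ _≡_ s × Independent L s) ×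
  (∀ (s : Fin (suc d) → Fin n) → Injective _≡_ _≡_ s → ¬ Independent L s)

IsUniform : ∀ {ℓ n} → (SignVec n → Set ℓ) → ℕ → Set ℓ
IsUniform {n = n} L d = HasRank L d ×
  (∀ (s : Fin d → Fin n) → Injective _≡_ _≡_ s → Independent L s)

-- Pick i₀ with X(e i₀) ≠ 0 (it exists: in a uniform rank-d oriented matroid a
-- covector vanishing on d elements is zero).  Then Xs i₀ ≼ X, and minimality of
-- the cocircuit X forces X = Xs i₀.  On D this is read off from the hypotheses;
-- the content is at f ∉ D with Y(f) ≠ 0, where Y = Xs i₀.  If X(f) ≠ Y(f), the
-- covector X ∘ (-Y) conforms to the Xs on D and takes the value -Y(f) at f.
-- Eliminating each e_k against -Xs k clears D one element at a time and keeps
-- -Y(f) at f, because every Xs k equals Y off D.  The result is a nonzero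
-- covector vanishing on D, which is impossible.
module Submission where

open import Defs
open import Level using (Level)
open import Data.Nat using (ℕ)
open import Data.Fin using (Fin; zero; suc; _≟_)
open import Data.Fin.Properties using (any?; ¬∀⟶∃¬)
open import Data.Vec using (lookup; tabulate)
open import Data.Vec.Functional as Vector using ()
open import Data.Vec.Properties using (lookup-map; lookup-zipWith; lookup-replicate; tabulate∘lookup; tabulate-cong)
open import Data.List using ([]; _∷_; allFin)
open import Data.List.Relation.Unary.Any using (here; there)
open import Data.List.Membership.Propositional using (_∈_)
open import Data.List.Membership.Propositional.Properties using (∈-allFin)
open import Data.Product using (∃; ∃-syntax; _×_; _,_; proj₁; proj₂)
open import Data.Sum using (_⊎_; inj₁; inj₂)
open import Data.Empty using (⊥-elim)
open import Relation.Nullary using (¬_; yes; no)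
open import Relation.Binary.Definitions using (DecidableEquality)
open import Relation.Binary.PropositionalEquality using (_≡_; _≢_; refl; sym; ≢-sym; trans; cong; subst; module ≡-Reasoning)
open import Function.Definitions using (Injective)

_≟ˢ_ : DecidableEquality Sign
pos ≟ˢ pos = yes refl
neg ≟ˢ neg = yes refl
nil ≟ˢ nil = yes refl
pos ≟ˢ neg = no λ ()
pos ≟ˢ nil = no λ ()
neg ≟ˢ pos = no λ ()
neg ≟ˢ nil = no λ ()
nil ≟ˢ pos = no λ ()
nil ≟ˢ neg = no λ ()

opp-involutive : ∀ s → opp (opp s) ≡ s
opp-involutive pos = refl
opp-involutive neg = refl
opp-involutive nil = refl

opp-fixed⇒nil : ∀ {s} → s ≡ opp s → s ≡ nil
opp-fixed⇒nil {nil} _ = refl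

nonzero-signs : ∀ {a b} → a ≢ nil → b ≢ nil → a ≡ b ⊎ a ≡ opp b
nonzero-signs {pos} {pos} _ _ = inj₁ refl
nonzero-signs {pos} {neg} _ _ = inj₂ refl
nonzero-signs {neg} {pos} _ _ = inj₂ refl
nonzero-signs {neg} {neg} _ _ = inj₁ refl
nonzero-signs {nil} a≢nil _ = ⊥-elim (a≢nil refl)
nonzero-signs {_} {nil} _ b≢nil = ⊥-elim (b≢nil refl)

opp-nonzero : ∀ {s} → s ≢ nil → opp s ≢ nil
opp-nonzero {pos} _ ()
opp-nonzero {neg} _ ()
opp-nonzero {nil} s≢nil = ⊥-elim (s≢nil refl)

composeS-identityʳ : ∀ s → composeS s nil ≡ s
composeS-identityʳ pos = refl
composeS-identityʳ neg = refl
composeS-identityʳ nil = refl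

composeS-idem : ∀ s → composeS s s ≡ s
composeS-idem pos = refl
composeS-idem neg = refl
composeS-idem nil = refl

composeS-nonzeroˡ : ∀ {s} t → s ≢ nil → composeS s t ≡ s
composeS-nonzeroˡ {pos} _ _ = refl
composeS-nonzeroˡ {neg} _ _ = refl
composeS-nonzeroˡ {nil} _ s≢nil = ⊥-elim (s≢nil refl)

composeS-opp : ∀ {s y} → y ≢ nil → s ≢ y → composeS s (opp y) ≡ opp y
composeS-opp {nil} _ _ = refl
composeS-opp {pos} {pos} _ s≢y = ⊥-elim (s≢y refl)
composeS-opp {pos} {neg} _ _ = refl
composeS-opp {neg} {pos} _ _ = refl
composeS-opp {neg} {neg} _ s≢y = ⊥-elim (s≢y refl)
composeS-opp {_} {nil} y≢nil _ = ⊥-elim (y≢nil refl)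

module _ {n : ℕ} where

  lookup-negVec : ∀ (X : SignVec n) g → lookup (negVec X) g ≡ opp (lookup X g)
  lookup-negVec X g = lookup-map g opp X

  opp-lookup-negVec : ∀ (X : SignVec n) g → opp (lookup (negVec X) g) ≡ lookup X g
  opp-lookup-negVec X g = trans (cong opp (lookup-negVec X g)) (opp-involutive _)

  lookup-compose : ∀ (X Y : SignVec n) g →
    lookup (compose X Y) g ≡ composeS (lookup X g) (lookup Y g)
  lookup-compose X Y g = lookup-zipWith composeS g X Y

  lookup-zeroVec : ∀ g → lookup (zeroVec {n}) g ≡ nil
  lookup-zeroVec g = lookup-replicate g nil

  nil-¬separates : ∀ (A B : SignVec n) {g} → lookup B g ≡ nil → ¬ Separates A B g
  nil-¬separates _ _ Bg≡nil (Ag≢nil , Ag≡-Bg) = Ag≢nil (trans Ag≡-Bg (cong opp Bg≡nil))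

  ≡-¬separates : ∀ (A B : SignVec n) {g} → lookup A g ≡ lookup B g → ¬ Separates A B g
  ≡-¬separates _ _ Ag≡Bg (Ag≢nil , Ag≡-Bg) = Ag≢nil (opp-fixed⇒nil (trans Ag≡-Bg (cong opp (sym Ag≡Bg))))

  ≡zeroVec : ∀ (X : SignVec n) → (∀ g → lookup X g ≡ nil) → X ≡ zeroVec
  ≡zeroVec X X≡nil = begin
    X                        ≡⟨ sym (tabulate∘lookup X) ⟩
    tabulate (lookup X)       ≡⟨ tabulate-cong (λ g → trans (X≡nil g) (sym (lookup-zeroVec g))) ⟩
    tabulate (lookup zeroVec) ≡⟨ tabulate∘lookup zeroVec ⟩
    zeroVec                  ∎
    where open ≡-Reasoning

cons-injective : ∀ {n d} {h : Fin n} {g : Fin d → Fin n} →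
  (∀ j → g j ≢ h) → Injective _≡_ _≡_ g → Injective _≡_ _≡_ (h Vector.∷ g)
cons-injective g≢h g-inj {zero}  {zero}  _ = refl
cons-injective g≢h g-inj {zero}  {suc j} h≡gj = ⊥-elim (g≢h j (sym h≡gj))
cons-injective g≢h g-inj {suc i} {zero}  gi≡h = ⊥-elim (g≢h i gi≡h)
cons-injective g≢h g-inj {suc i} {suc j} gi≡gj = cong suc (g-inj gi≡gj)

≼-cocircuit⇒≡ : ∀ {ℓ n} (L : SignVec n → Set ℓ) {X Y : SignVec n} →
  IsCocircuit L Y → IsCocircuit L X → Y ≼ X → Y ≡ X
≼-cocircuit⇒≡ L (LY , Y≢0 , _) (_ , _ , X-minimal) Y≼X with X-minimal _ LY Y≼X
... | inj₁ Y≡0 = ⊥-elim (Y≢0 Y≡0)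
... | inj₂ Y≡X = Y≡X

module OrientedMatroid {ℓ : Level} {n : ℕ} {L : SignVec n → Set ℓ}
  (om : IsOrientedMatroid n L) where
  open IsOrientedMatroid om

  eliminate : ∀ {A B h} → L A → L B → Separates A B h →
    ∃[ Z ] L Z × lookup Z h ≡ nil ×
      (∀ g → lookup B g ≡ nil ⊎ lookup A g ≡ lookup B g → lookup Z g ≡ lookup A g)
  eliminate {A} {B} {h} LA LB sep with L3 A B LA LB h sep
  ... | Z , LZ , Zh≡nil , Z≡A∘B = Z , LZ , Zh≡nil , agrees
    where
    agrees : ∀ g → lookup B g ≡ nil ⊎ lookup A g ≡ lookup B g → lookup Z g ≡ lookup A g
    agrees g (inj₁ Bg≡nil) = begin
      lookup Z g                          ≡⟨ Z≡A∘B g (nil-¬separates A B Bg≡nil) ⟩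
      lookup (compose A B) g              ≡⟨ lookup-compose A B g ⟩
      composeS (lookup A g) (lookup B g)  ≡⟨ cong (composeS (lookup A g)) Bg≡nil ⟩
      composeS (lookup A g) nil           ≡⟨ composeS-identityʳ _ ⟩
      lookup A g                          ∎
      where open ≡-Reasoning
    agrees g (inj₂ Ag≡Bg) = begin
      lookup Z g                          ≡⟨ Z≡A∘B g (≡-¬separates A B Ag≡Bg) ⟩
      lookup (compose A B) g              ≡⟨ lookup-compose A B g ⟩
      composeS (lookup A g) (lookup B g)  ≡⟨ cong (composeS (lookup A g)) (sym Ag≡Bg) ⟩
      composeS (lookup A g) (lookup A g)  ≡⟨ composeS-idem _ ⟩
      lookup A g                          ∎
      where open ≡-Reasoning

  ±-opposite-at : ∀ {Z h s} → L Z → lookup Z h ≢ nil → s ≢ nil →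
    ∃[ Z′ ] L Z′ × s ≡ opp (lookup Z′ h) × (∀ g → lookup Z g ≡ nil → lookup Z′ g ≡ nil)
  ±-opposite-at {Z} {h} LZ Zh≢nil s≢nil with nonzero-signs s≢nil Zh≢nil
  ... | inj₂ s≡-Zh = Z , LZ , s≡-Zh , λ _ Zg≡nil → Zg≡nil
  ... | inj₁ s≡Zh  = negVec Z , L1 Z LZ ,
          trans s≡Zh (sym (opp-lookup-negVec Z h)) ,
          λ g Zg≡nil → trans (lookup-negVec Z g) (cong opp Zg≡nil)

  vanish-at : ∀ {W Z h} → L W → L Z → lookup Z h ≢ nil →
    ∃[ V ] L V × lookup V h ≡ nil × (∀ g → lookup Z g ≡ nil → lookup V g ≡ lookup W g)
  vanish-at {W} {Z} {h} LW LZ Zh≢nil with lookup W h ≟ˢ nil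
  ... | yes Wh≡nil = W , LW , Wh≡nil , λ _ _ → refl
  ... | no Wh≢nil with ±-opposite-at LZ Zh≢nil Wh≢nil
  ...   | Z′ , LZ′ , Wh≡-Z′h , Z′-supp with eliminate LW LZ′ (Wh≢nil , Wh≡-Z′h)
  ...     | V , LV , Vh≡nil , V≡W = V , LV , Vh≡nil , λ g Zg≡nil → V≡W g (inj₁ (Z′-supp g Zg≡nil))

  independent-cons : ∀ {k Z h} {g : Fin k → Fin n} → L Z → lookup Z h ≢ nil →
    (∀ j → lookup Z (g j) ≡ nil) → Independent L g → Independent L (h Vector.∷ g)
  independent-cons {Z = Z} LZ Zh≢nil Z-g _ zero = Z , LZ , Zh≢nil , λ
    { zero 0≢0 → ⊥-elim (0≢0 refl)
    ; (suc j) _ → Z-g j }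
  independent-cons {g = g} LZ Zh≢nil Z-g g-indep (suc i) with g-indep i
  ... | W , LW , Wgi≢nil , W-g with vanish-at LW LZ Zh≢nil
  ...   | V , LV , Vh≡nil , V≡W = V , LV , Vgi≢nil , λ
          { zero _ → Vh≡nil
          ; (suc j) sj≢si → trans (V≡W (g j) (Z-g j)) (W-g j (λ j≡i → sj≢si (cong suc j≡i))) }
    where
    Vgi≢nil : lookup V (g i) ≢ nil
    Vgi≢nil Vgi≡nil = Wgi≢nil (trans (sym (V≡W (g i) (Z-g i))) Vgi≡nil)

  -- Otherwise h ∷ g, with Z(h) ≠ 0, would be d + 1 independent elements.
  vanishes-on-basis⇒≡zeroVec : ∀ {d Z} → IsUniform L d → L Z →
    (g : Fin d → Fin n) → Injective _≡_ _≡_ g → (∀ j → lookup Z (g j) ≡ nil) → Z ≡ zeroVec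
  vanishes-on-basis⇒≡zeroVec {Z = Z} ((_ , no-independent-extension) , all-independent) LZ g g-inj Z-g =
    ≡zeroVec Z Z≡nil
    where
    Z≡nil : ∀ h → lookup Z h ≡ nil
    Z≡nil h with lookup Z h ≟ˢ nil
    ... | yes Zh≡nil = Zh≡nil
    ... | no Zh≢nil = ⊥-elim (no-independent-extension (h Vector.∷ g)
            (cons-injective (λ j gj≡h → Zh≢nil (subst (λ x → lookup Z x ≡ nil) gj≡h (Z-g j))) g-inj)
            (independent-cons LZ Zh≢nil Z-g (all-independent g g-inj)))

  -- Clearing e_k against -(Xs k) leaves Z unchanged on the other e_j (where Xs k
  -- vanishes) and at f (where Z and -(Xs k) agree).
  module Sweep {d} (e : Fin d → Fin n) (Xs : Fin d → SignVec n) (L-Xs : ∀ i → L (Xs i))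
    (orth : ∀ i j → i ≢ j → lookup (Xs i) (e j) ≡ nil)
    (f : Fin n) (c : Sign) (Xs-f : ∀ k → lookup (Xs k) f ≡ c) where

    Sweepable : SignVec n → Set ℓ
    Sweepable Z = L Z × lookup Z f ≡ opp c ×
      (∀ j → lookup Z (e j) ≡ lookup (Xs j) (e j) ⊎ lookup Z (e j) ≡ nil)

    clear : ∀ {Z} → Sweepable Z → ∀ k → ∃[ Z′ ] Sweepable Z′ × lookup Z′ (e k) ≡ nil ×
      (∀ j → j ≢ k → lookup Z′ (e j) ≡ lookup Z (e j))
    clear {Z} sweepable k with lookup Z (e k) ≟ˢ nil
    ... | yes Zek≡nil = Z , sweepable , Zek≡nil , λ _ _ → refl
    clear {Z} (LZ , Zf≡-c , Z-conf) k | no Zek≢nil with Z-conf k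
    ... | inj₂ Zek≡nil = ⊥-elim (Zek≢nil Zek≡nil)
    ... | inj₁ Zek≡Xsk
          with eliminate LZ (L1 _ (L-Xs k)) (Zek≢nil , trans Zek≡Xsk (sym (opp-lookup-negVec (Xs k) (e k))))
    ...   | Z′ , LZ′ , Z′ek≡nil , Z′≡Z =
            Z′ , (LZ′ , trans (Z′≡Z f (inj₂ Zf≡-Xskf)) Zf≡-c , Z′-conf) , Z′ek≡nil , unchanged
      where
      Zf≡-Xskf : lookup Z f ≡ lookup (negVec (Xs k)) f
      Zf≡-Xskf = trans Zf≡-c (trans (cong opp (sym (Xs-f k))) (sym (lookup-negVec (Xs k) f)))
      unchanged : ∀ j → j ≢ k → lookup Z′ (e j) ≡ lookup Z (e j)
      unchanged j j≢k =
        Z′≡Z (e j) (inj₁ (trans (lookup-negVec (Xs k) (e j)) (cong opp (orth k j (≢-sym j≢k)))))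
      Z′-conf : ∀ j → lookup Z′ (e j) ≡ lookup (Xs j) (e j) ⊎ lookup Z′ (e j) ≡ nil
      Z′-conf j with j ≟ k
      ... | yes refl = inj₂ Z′ek≡nil
      ... | no j≢k = subst (λ s → s ≡ lookup (Xs j) (e j) ⊎ s ≡ nil) (sym (unchanged j j≢k)) (Z-conf j)

    clear-all : ∀ {Z} → Sweepable Z → ∀ ks →
      ∃[ Z′ ] Sweepable Z′ × (∀ j → j ∈ ks → lookup Z′ (e j) ≡ nil)
    clear-all sweepable [] = _ , sweepable , λ _ ()
    clear-all sweepable (k ∷ ks) with clear-all sweepable ks
    ... | Z , sweepable-Z , Z-ks with clear sweepable-Z k
    ...   | Z′ , sweepable-Z′ , Z′ek≡nil , unchanged = Z′ , sweepable-Z′ , cleared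
      where
      cleared : ∀ j → j ∈ k ∷ ks → lookup Z′ (e j) ≡ nil
      cleared j (here refl) = Z′ek≡nil
      cleared j (there j∈ks) with j ≟ k
      ... | yes refl = Z′ek≡nil
      ... | no j≢k = trans (unchanged j j≢k) (Z-ks j j∈ks)

    sweep : ∀ {Z} → Sweepable Z →
      ∃[ Z′ ] L Z′ × lookup Z′ f ≡ opp c × (∀ j → lookup Z′ (e j) ≡ nil)
    sweep sweepable with clear-all sweepable (allFin d)
    ... | Z , (LZ , Zf≡-c , _) , Z-D = Z , LZ , Zf≡-c , λ j → Z-D j (∈-allFin j)

module ConformalCocircuit {ℓ : Level} {n d : ℕ} {L : SignVec n → Set ℓ}
  (om : IsOrientedMatroid n L) (uniform : IsUniform L d)
  (e : Fin d → Fin n) (e-inj : Injective _≡_ _≡_ e)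
  (Xs : Fin d → SignVec n) (coc : ∀ i → IsCocircuit L (Xs i))
  (orth : ∀ i j → i ≢ j → lookup (Xs i) (e j) ≡ nil)
  (agree : ∀ i k f → (∀ j → e j ≢ f) → lookup (Xs i) f ≡ lookup (Xs k) f)
  (X : SignVec n) (cocX : IsCocircuit L X)
  (X-conf : ∀ i → (lookup X (e i) ≡ lookup (Xs i) (e i)) ⊎ (lookup X (e i) ≡ nil)) where
  open IsOrientedMatroid om using (L1; L2)
  open OrientedMatroid om

  LX : L X
  LX = proj₁ cocX

  pivot : ∃[ i₀ ] lookup X (e i₀) ≢ nil
  pivot = ¬∀⟶∃¬ d _ (λ j → lookup X (e j) ≟ˢ nil)
            (λ X-D≡nil → proj₁ (proj₂ cocX) (vanishes-on-basis⇒≡zeroVec uniform LX e e-inj X-D≡nil))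

  i₀ : Fin d
  i₀ = proj₁ pivot

  Y : SignVec n
  Y = Xs i₀

  X-at-pivot : lookup X (e i₀) ≡ lookup Y (e i₀)
  X-at-pivot with X-conf i₀
  ... | inj₁ Xe≡Ye = Xe≡Ye
  ... | inj₂ Xe≡nil = ⊥-elim (proj₂ pivot Xe≡nil)

  X∘-Y-on-D : ∀ j → lookup (compose X (negVec Y)) (e j) ≡ lookup X (e j)
  X∘-Y-on-D j with j ≟ i₀
  ... | yes refl = trans (lookup-compose X _ (e j)) (composeS-nonzeroˡ _ (proj₂ pivot))
  ... | no j≢i₀ = begin
    lookup (compose X (negVec Y)) (e j) ≡⟨ lookup-compose X _ (e j) ⟩
    composeS x (lookup (negVec Y) (e j)) ≡⟨ cong (composeS x) (lookup-negVec Y (e j)) ⟩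
    composeS x (opp (lookup Y (e j)))    ≡⟨ cong (λ s → composeS x (opp s)) (orth i₀ j (≢-sym j≢i₀)) ⟩
    composeS x nil                       ≡⟨ composeS-identityʳ x ⟩
    x                                    ∎
    where
    open ≡-Reasoning
    x : Sign
    x = lookup X (e j)

  agrees-off-D : ∀ f → (∀ j → e j ≢ f) → lookup Y f ≢ nil → lookup X f ≡ lookup Y f
  agrees-off-D f f∉D Yf≢nil with lookup X f ≟ˢ lookup Y f
  ... | yes Xf≡Yf = Xf≡Yf
  ... | no Xf≢Yf with sweep (L2 X _ LX (L1 Y LY) , Z₀f≡-Yf , Z₀-conf)
    where
    open Sweep e Xs (λ i → proj₁ (coc i)) orth f (lookup Y f) (λ k → agree k i₀ f f∉D)
    LY : L Y
    LY = proj₁ (coc i₀)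
    Z₀f≡-Yf : lookup (compose X (negVec Y)) f ≡ opp (lookup Y f)
    Z₀f≡-Yf = trans (lookup-compose X _ f)
                (trans (cong (composeS (lookup X f)) (lookup-negVec Y f)) (composeS-opp Yf≢nil Xf≢Yf))
    Z₀-conf : ∀ j → lookup (compose X (negVec Y)) (e j) ≡ lookup (Xs j) (e j)
                  ⊎ lookup (compose X (negVec Y)) (e j) ≡ nil
    Z₀-conf j = subst (λ s → s ≡ lookup (Xs j) (e j) ⊎ s ≡ nil) (sym (X∘-Y-on-D j)) (X-conf j)
  ... | Z , LZ , Zf≡-Yf , Z-D≡nil = ⊥-elim (opp-nonzero Yf≢nil (begin
    opp (lookup Y f)   ≡⟨ sym Zf≡-Yf ⟩
    lookup Z f         ≡⟨ cong (λ V → lookup V f)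
                            (vanishes-on-basis⇒≡zeroVec uniform LZ e e-inj Z-D≡nil) ⟩
    lookup zeroVec f   ≡⟨ lookup-zeroVec f ⟩
    nil                ∎))
    where open ≡-Reasoning

  Y≼X : Y ≼ X
  Y≼X g with any? (λ j → e j ≟ g)
  ... | yes (j , refl) with j ≟ i₀
  ...   | yes refl = inj₂ (sym X-at-pivot)
  ...   | no j≢i₀ = inj₁ (orth i₀ j (≢-sym j≢i₀))
  Y≼X g | no g∉D with lookup Y g ≟ˢ nil
  ... | yes Yg≡nil = inj₁ Yg≡nil
  ... | no Yg≢nil = inj₂ (sym (agrees-off-D g (λ j ej≡g → g∉D (j , ej≡g)) Yg≢nil))

mainTheorem3 : ∀ {ℓ : Level} (n d : ℕ) (L : SignVec n → Set ℓ) →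
    IsOrientedMatroid n L → IsUniform L d →
    (e : Fin d → Fin n) → Injective _≡_ _≡_ e →
    (Xs : Fin d → SignVec n) →
    (∀ i → IsCocircuit L (Xs i)) →
    (∀ i j → i ≢ j → lookup (Xs i) (e j) ≡ nil) →
    (∀ i k f → (∀ j → e j ≢ f) → lookup (Xs i) f ≡ lookup (Xs k) f) →
    (X : SignVec n) → IsCocircuit L X →
    (∀ i → (lookup X (e i) ≡ lookup (Xs i) (e i)) ⊎ (lookup X (e i) ≡ nil)) →
    ∃ λ i → X ≡ Xs i
mainTheorem3 n d L om uniform e e-inj Xs coc orth agree X cocX X-conf =
  i₀ , sym (≼-cocircuit⇒≡ L (coc i₀) cocX Y≼X)
  where open ConformalCocircuit om uniform e e-inj Xs coc orth agree X cocX X-conf
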